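{- Let $U\subset\mathcal{T}$ be a finite set of terms in $\mathbf{k}[x_1,\dots,x_n]$ with $x_1<\dots<x_n$, and let $\mathcal{B}$ be its Bar Code. Let $t\in U$, let $p=x_i^{k_i}\in NMP(t,U)$ be a nonmultiplicative power of $t$, and let $\mathcal{B}^{(i)}_j$ be the $i$-bar under $t$. Let $s\in U$. Then $s$ is a Janet-like divisor of $pt$ if and only if the following three conditions hold: (1) $s$ divides $pt$ (ordinary divisibility); (2) $s$ lies over $\mathcal{B}^{(i)}_{j+1}$; (3) for every $j'$ such that $x_{j'}$ divides $\frac{pt}{s}$, either there is a star immediately after the $j'$-bar under $s$, or the nonmultiplicative power of $s$ with respect to $x_{j'}$ has degree greater than $\deg_{j'}\!\left(\frac{pt}{s}\right)$.
   Context: $\mathcal{T}$ is the set of terms (monomials) $x_1^{\gamma_1}\cdots x_n^{\gamma_n}$, $\deg_h(t)$ is the exponent of $x_h$ in $t$, and $<$ is the lexicographic order induced by $x_1<\dots<x_n$ (compare exponents of $x_n$ first, then $x_{n-1}$, etc.). For a term $t=x_1^{\gamma_1}\cdots x_n^{\gamma_n}$ let $\pi^i(t)=x_i^{\gamma_i}\cdots x_n^{\gamma_n}$. Bar Code of $U$: order $U$ increasingly w.r.t. Lex as $t_1<\dots<t_m$; form the $n\times m$ matrix whose $(i,c)$ entry is $\pi^i(t_c)$. In row $i$, each maximal block of consecutive equal entries is underlined by a segment, called an $i$-bar; the $i$-bars are numbered $\mathcal{B}^{(i)}_1,\dots,\mathcal{B}^{(i)}_{\mu(i)}$ from left to right.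 A term $t_c$ lies over the $i$-bar whose segment covers column $c$ (the "$i$-bar under $t_c$"); each $i$-bar lies over a unique $(i+1)$-bar. Stars: for each $1\le i\le n$, a star is placed to the right of the last bar $\mathcal{B}^{(i)}_{\mu(i)}$; for each $1\le i\le n-1$ and $1\le j\le\mu(i)-1$, if $\mathcal{B}^{(i)}_j$ and $\mathcal{B}^{(i)}_{j+1}$ do not lie over the same $(i+1)$-bar, a star is placed between them. No other stars are placed. (A star after the $i$-bar under $s$ means exactly that $x_i$ is Janet-multiplicative for $s$, i.e. no $v\in U$ has $\deg_l(v)=\deg_l(s)$ for $l>i$ and $\deg_i(v)>\deg_i(s)$.) Janet-like nonmultiplicative powers: for $u\in U$ and $1\le i\le n$, let $h_i(u,U)=\max\{\deg_i(v): v\in U,\ \deg_l(v)=\deg_l(u)\ \forall l=i+1,\dots,n\}-\deg_i(u)$. If $h_i(u,U)>0$, set $k_i=\min\{\deg_i(v)-\deg_i(u): v\in U,\ \deg_l(v)=\deg_l(u)\ \forall l=i+1,\dots,n,\ \deg_i(v)>\deg_i(u)\}$; then $x_i^{k_i}$ is the nonmultiplicative power of $u$ with respect to $x_i$. $NMP(u,U)$ is the set of nonmultiplicative powers of $u$. Janet-like division: $NM(u,U)=\{v\in\mathcal{T}:\exists w\in NMP(u,U),\ w\mid v\}$ and $M(u,U)=\mathcal{T}\setminus NM(u,U)$. A term $u\in U$ is a Janet-like divisor of $w\in\mathcal{T}$ (written "$u\mid w$ w.r.t. Janet-like division") if $w=uv$ with $v\in M(u,U)$. -}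

module Defs where

open import Data.Nat using (ℕ; zero; suc; _+_; _∸_; _≤_; _<_; _<ᵇ_)
import Data.Nat as ℕ
open import Data.Fin using (Fin; toℕ)
open import Data.Vec using (Vec; lookup; tabulate; zipWith; replicate; _[_]≔_)
open import Data.Vec.Properties using (≡-dec)
open import Data.List using (List; []; _∷_; length)
import Data.List as L
open import Data.List.Membership.Propositional using (_∈_)
open import Data.Product using (Σ; ∃; ∃-syntax; _×_; _,_)
open import Data.Sum using (_⊎_)
open import Data.Bool using (if_then_else_)
open import Relation.Nullary using (¬_; does)
open import Relation.Binary.PropositionalEquality using (_≡_; _≢_)

-- A term x_1^{γ_1} ⋯ x_n^{γ_n} is its exponent vector; variable x_{h+1}
-- corresponds to the index h : Fin n.
Term : ℕ → Set
Term n = Vec ℕ n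

deg : ∀ {n} → Fin n → Term n → ℕ
deg h t = lookup t h

_·_ : ∀ {n} → Term n → Term n → Term n
a · b = zipWith _+_ a b

power : ∀ {n} → Fin n → ℕ → Term n
power {n} i k = replicate n 0 [ i ]≔ k

_∣_ : ∀ {n} → Term n → Term n → Set
s ∣ w = ∃[ v ] (w ≡ s · v)

-- quotient w / s (exact whenever s ∣ w)
_/_ : ∀ {n} → Term n → Term n → Term n
w / s = zipWith _∸_ w s

-- Lex order with x_1 < ... < x_n : compare the exponent of x_n first
_<Lex_ : ∀ {n} → Term n → Term n → Set
a <Lex b = ∃[ h ] (deg h a < deg h b × (∀ l → toℕ h < toℕ l → deg l a ≡ deg l b))

π : ∀ {n} → Fin n → Term n → Term n
π i t = tabulate (λ l → if toℕ l <ᵇ toℕ i then 0 else lookup t l)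

-- Bar Code.  The finite set U is given by its Lex-increasing enumeration
-- t_1 < ... < t_m (a List); columns are 0-based positions in this list.

-- barAt i L c = number (1-based) of the i-bar covering column c
-- (maximal blocks of consecutive equal entries π^i(t_c) in row i).
barAt : ∀ {n} → Fin n → List (Term n) → ℕ → ℕ
barAt i (a ∷ b ∷ L) (suc c) =
  (if does (≡-dec ℕ._≟_ (π i a) (π i b)) then 0 else 1) + barAt i (b ∷ L) c
barAt i _ _ = 1

barUnder : ∀ {n} → Fin n → (U : List (Term n)) → Fin (length U) → ℕ
barUnder i U c = barAt i U (toℕ c)

μ : ∀ {n} → Fin n → List (Term n) → ℕ
μ i U = barAt i U (length U ∸ 1)

LiesOver : ∀ {n} → (i i' : Fin n) → (U : List (Term n)) → ℕ → ℕ → Set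
LiesOver i i' U b b' = ∃[ e ] (barUnder i U e ≡ b × barUnder i' U e ≡ b')

StarAfter : ∀ {n} → Fin n → List (Term n) → ℕ → Set
StarAfter {n} i U b =
  b ≡ μ i U
  ⊎ (b < μ i U ×
     Σ (Fin n) (λ i' → toℕ i' ≡ suc (toℕ i) ×
        ¬ (∃[ b' ] (LiesOver i i' U b b' × LiesOver i i' U (suc b) b'))))

SameTail : ∀ {n} → Fin n → Term n → Term n → Set
SameTail i u v = ∀ l → toℕ i < toℕ l → deg l v ≡ deg l u

-- x_i^k ∈ NMP(u,U): k = k_i is the minimum of the positive differences
-- deg_i(v) - deg_i(u) over v ∈ U with the same tail (exists iff h_i(u,U) > 0)
NMPow : ∀ {n} → List (Term n) → Term n → Fin n → ℕ → Set
NMPow U u i k =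
  (∃[ v ] (v ∈ U × SameTail i u v × 0 < k × deg i v ≡ deg i u + k))
  × (∀ v → v ∈ U → SameTail i u v → deg i u < deg i v → deg i u + k ≤ deg i v)

NM : ∀ {n} → List (Term n) → Term n → Term n → Set
NM U u v = ∃[ i ] ∃[ k ] (NMPow U u i k × power i k ∣ v)

JLDivides : ∀ {n} → List (Term n) → Term n → Term n → Set
JLDivides U u w = ∃[ v ] (w ≡ u · v × ¬ NM U u v)

module Submission where

-- Everything runs through one relation: terms
-- "agree from position m" when their exponents of x_l coincide for all l ≥ m.
-- Since U is listed Lex-increasingly, agreeing terms form intervals of the
-- list, so two columns lie over the same i-bar iff they agree from i.  After
-- general facts on agreement, Lex order, bar numbering, monomial arithmetic
-- and nonmultiplicative powers, we prove:
--   * a star follows the j-bar under s iff no u ∈ U lies above s in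
--     direction j, i.e. iff x_j is multiplicative for s;
--   * the term realising x_i^k lies over the i-bar right after t's;
--   * a Janet-like divisor s of w agrees from m with w as soon as some u ∈ U
--     does (descending induction on the variables).
-- The realiser agrees with p·t from i, giving condition (2); condition (3)
-- says no nonmultiplicative power of s divides p·t/s, which together with
-- (1) is exactly Janet-like divisibility.

open import Defs
open import Data.Nat using (ℕ; zero; suc; _<_; _≤_; _+_; _∸_; z≤n; s≤s; _<ᵇ_; _≟_; _<?_)
open import Data.Nat.Properties
open import Data.Fin using (Fin; toℕ; fromℕ<)
open import Data.Fin.Properties using (toℕ-injective; toℕ<n; toℕ-fromℕ<)
import Data.Fin.Properties as Fin
open import Data.List using (List; []; _∷_; length; lookup; filter)
open import Data.List.Relation.Unary.Linked using (Linked; [-]; _∷_)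
open import Data.List.Relation.Unary.Any using (Any; here; there; any?; index)
open import Data.List.Relation.Unary.Any.Properties using (lookup-index)
import Data.List.Relation.Unary.All as All
open import Data.List.Membership.Propositional using (_∈_; find; lose)
open import Data.List.Membership.Propositional.Properties using (∈-filter⁺; ∈-filter⁻)
open import Data.List.Extrema.Nat using (argmin; argmin-all; f[argmin]≤f[xs])
open import Data.Vec using (replicate) renaming (lookup to entry)
open import Data.Vec.Properties
  using ( lookup-zipWith; lookup∘update; lookup∘update′; lookup-replicate
        ; tabulate∘lookup; tabulate-cong; lookup∘tabulate; ≡-dec)
open import Data.Product using (∃-syntax; _×_; _,_; proj₁; proj₂)
open import Data.Sum using (_⊎_; inj₁; inj₂)
open import Data.Empty using (⊥; ⊥-elim)
open import Data.Unit using (tt)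
open import Data.Bool using (true; false; T; if_then_else_)
open import Relation.Nullary using (¬_; yes; no; does)
open import Relation.Nullary.Decidable using (_×-dec_; _→-dec_)
open import Relation.Unary using (Decidable)
open import Relation.Binary.Definitions using (tri<; tri≈; tri>)
open import Function using (_∘_)
open import Function.Bundles using (_⇔_; mk⇔)
open import Relation.Binary.PropositionalEquality

record AgreeFrom {n} (m : ℕ) (a b : Term n) : Set where
  constructor agree
  field agreeAt : ∀ (l : Fin n) → m ≤ toℕ l → deg l a ≡ deg l b
open AgreeFrom

module _ {n : ℕ} where

  agree-refl : ∀ {m} {a : Term n} → AgreeFrom m a a
  agree-refl = agree λ _ _ → refl

  agree-sym : ∀ {m} {a b : Term n} → AgreeFrom m a b → AgreeFrom m b a
  agree-sym ag = agree λ l m≤l → sym (agreeAt ag l m≤l)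

  agree-trans : ∀ {m} {a b c : Term n} → AgreeFrom m a b → AgreeFrom m b c → AgreeFrom m a c
  agree-trans ab bc = agree λ l m≤l → trans (agreeAt ab l m≤l) (agreeAt bc l m≤l)

  agree-weaken : ∀ {m m′} {a b : Term n} → m ≤ m′ → AgreeFrom m a b → AgreeFrom m′ a b
  agree-weaken m≤m′ ag = agree λ l m′≤l → agreeAt ag l (≤-trans m≤m′ m′≤l)

  agree-beyond : ∀ {m} {a b : Term n} → n ≤ m → AgreeFrom m a b
  agree-beyond n≤m = agree λ l m≤l → ⊥-elim (<⇒≱ (toℕ<n l) (≤-trans n≤m m≤l))

  agree-extend : ∀ {m} {a b : Term n} →
    (∀ l → toℕ l ≡ m → deg l a ≡ deg l b) → AgreeFrom (suc m) a b → AgreeFrom m a b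
  agree-extend {m} {a} {b} at-m ag = agree extended
    where
    extended : ∀ l → m ≤ toℕ l → deg l a ≡ deg l b
    extended l m≤l with m≤n⇒m<n∨m≡n m≤l
    ... | inj₁ m<l = agreeAt ag l m<l
    ... | inj₂ m≡l = at-m l (sym m≡l)

  agree-extendAt : ∀ {i : Fin n} {a b : Term n} →
    deg i a ≡ deg i b → AgreeFrom (suc (toℕ i)) a b → AgreeFrom (toℕ i) a b
  agree-extendAt {i} {a} {b} eq = agree-extend at-i
    where
    at-i : ∀ l → toℕ l ≡ toℕ i → deg l a ≡ deg l b
    at-i l l≡i with toℕ-injective l≡i
    ... | refl = eq

  agree-by-descent : ∀ {m} {a b : Term n} →
    (∀ l → m ≤ toℕ l → AgreeFrom (suc (toℕ l)) a b → deg l a ≡ deg l b) → AgreeFrom m a b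
  agree-by-descent {m} {a} {b} step = descend n m ≤-refl (m≤m+n n m)
    where
    descend : ∀ r m′ → m ≤ m′ → n ≤ r + m′ → AgreeFrom m′ a b
    descend zero    m′ _    n≤m′ = agree-beyond n≤m′
    descend (suc r) m′ m≤m′ n≤r+1+m′ = agree-extend at-m′ above
      where
      above : AgreeFrom (suc m′) a b
      above = descend r (suc m′) (m≤n⇒m≤1+n m≤m′) (subst (n ≤_) (sym (+-suc r m′)) n≤r+1+m′)
      at-m′ : ∀ l → toℕ l ≡ m′ → deg l a ≡ deg l b
      at-m′ l refl = step l m≤m′ above

  tail⇒agree : ∀ {i : Fin n} {u v : Term n} → SameTail i u v → AgreeFrom (suc (toℕ i)) u v
  tail⇒agree st = agree λ l i<l → sym (st l i<l)

  agree⇒tail : ∀ {i : Fin n} {u v : Term n} → AgreeFrom (suc (toℕ i)) u v → SameTail i u v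
  agree⇒tail ag l i<l = sym (agreeAt ag l i<l)

  <⇒≢Fin : ∀ {i l : Fin n} → toℕ i < toℕ l → l ≢ i
  <⇒≢Fin i<l refl = <-irrefl refl i<l

module _ {n : ℕ} where

  <Lex-irrefl : ∀ {a : Term n} → ¬ (a <Lex a)
  <Lex-irrefl (_ , lt , _) = <-irrefl refl lt

  <Lex-trans : ∀ {a b c : Term n} → a <Lex b → b <Lex c → a <Lex c
  <Lex-trans {a} {b} {c} (h₁ , lt₁ , ag₁) (h₂ , lt₂ , ag₂) with <-cmp (toℕ h₁) (toℕ h₂)
  ... | tri< p _ _ =
    h₂ , subst (_< deg h₂ c) (sym (ag₁ h₂ p)) lt₂ , λ l q → trans (ag₁ l (<-trans p q)) (ag₂ l q)
  ... | tri≈ _ p _ =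
    h₁ , <-trans lt₁ (subst (λ h → deg h b < deg h c) (sym (toℕ-injective p)) lt₂) ,
    λ l q → trans (ag₁ l q) (ag₂ l (subst (_< toℕ l) p q))
  ... | tri> _ _ p =
    h₁ , subst (deg h₁ a <_) (ag₂ h₁ p) lt₁ , λ l q → trans (ag₁ l q) (ag₂ l (<-trans p q))

  _≤Lex_ : Term n → Term n → Set
  a ≤Lex b = a ≡ b ⊎ a <Lex b

  ≤Lex⇒deg≤ : ∀ {j : Fin n} {a b : Term n} → a ≤Lex b → AgreeFrom (suc (toℕ j)) a b → deg j a ≤ deg j b
  ≤Lex⇒deg≤ (inj₁ refl) _ = ≤-refl
  ≤Lex⇒deg≤ {j} {a} {b} (inj₂ (h , lt , ag)) above-j with <-cmp (toℕ h) (toℕ j)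
  ... | tri< p _ _ = ≤-reflexive (ag j p)
  ... | tri≈ _ p _ = <⇒≤ (subst (λ x → deg x a < deg x b) (toℕ-injective p) lt)
  ... | tri> _ _ p = ⊥-elim (<⇒≢ lt (agreeAt above-j h p))

  <Lex⇒deg< : ∀ {j : Fin n} {a b : Term n} → a <Lex b →
    AgreeFrom (suc (toℕ j)) a b → ¬ AgreeFrom (toℕ j) a b → deg j a < deg j b
  <Lex⇒deg< lt above-j differ =
    ≤∧≢⇒< (≤Lex⇒deg≤ (inj₂ lt) above-j) (λ eq → differ (agree-extendAt eq above-j))

  agree-between : ∀ {m} {a b c : Term n} → a ≤Lex b → b ≤Lex c → AgreeFrom m a c → AgreeFrom m a b
  agree-between (inj₁ refl) _ _ = agree-refl
  agree-between (inj₂ _) (inj₁ refl) ac = ac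
  agree-between {m} {a} {b} {c} (inj₂ (h₁ , lt₁ , ag₁)) (inj₂ (h₂ , lt₂ , ag₂)) ac with toℕ h₁ <? m
  ... | yes h₁<m = agree λ l m≤l → ag₁ l (<-≤-trans h₁<m m≤l)
  ... | no h₁≮m with ≮⇒≥ h₁≮m | <-cmp (toℕ h₁) (toℕ h₂)
  ...   | m≤h₁ | tri< p _ _ =
    ⊥-elim (<⇒≢ lt₂ (trans (sym (ag₁ h₂ p)) (agreeAt ac h₂ (≤-trans m≤h₁ (<⇒≤ p)))))
  ...   | m≤h₁ | tri≈ _ p _ =
    ⊥-elim (<⇒≢ (<-trans lt₁ (subst (λ h → deg h b < deg h c) (sym (toℕ-injective p)) lt₂))
                (agreeAt ac h₁ m≤h₁))
  ...   | m≤h₁ | tri> _ _ p =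
    ⊥-elim (<⇒≢ lt₁ (trans (agreeAt ac h₁ m≤h₁) (sym (ag₂ h₁ p))))

module _ {n : ℕ} where

  π-entry : ∀ (i l : Fin n) (a : Term n) → toℕ i ≤ toℕ l → entry (π i a) l ≡ deg l a
  π-entry i l a i≤l rewrite lookup∘tabulate (λ l′ → if toℕ l′ <ᵇ toℕ i then 0 else entry a l′) l
    with toℕ l <ᵇ toℕ i in l<ᵇi
  ... | true  = ⊥-elim (≤⇒≯ i≤l (<ᵇ⇒< _ _ (subst T (sym l<ᵇi) tt)))
  ... | false = refl

  π≡⇒agree : ∀ (i : Fin n) {a b : Term n} → π i a ≡ π i b → AgreeFrom (toℕ i) a b
  π≡⇒agree i {a} {b} eq = agree λ l i≤l →
    trans (sym (π-entry i l a i≤l)) (trans (cong (λ v → entry v l) eq) (π-entry i l b i≤l))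

  agree⇒π≡ : ∀ (i : Fin n) {a b : Term n} → AgreeFrom (toℕ i) a b → π i a ≡ π i b
  agree⇒π≡ i {a} {b} ag = tabulate-cong same
    where
    same : ∀ l → (if toℕ l <ᵇ toℕ i then 0 else entry a l) ≡ (if toℕ l <ᵇ toℕ i then 0 else entry b l)
    same l with toℕ l <ᵇ toℕ i in l<ᵇi
    ... | true  = refl
    ... | false = agreeAt ag l (≮⇒≥ (λ l<i → subst T l<ᵇi (<⇒<ᵇ l<i)))

  -- The increment of the i-bar number between consecutive columns a, b
  -- (this is the summand in the definition of `barAt`).
  change : Fin n → Term n → Term n → ℕ
  change i a b = if does (≡-dec _≟_ (π i a) (π i b)) then 0 else 1

  ChangeCases : Fin n → Term n → Term n → Set
  ChangeCases i a b =
    (change i a b ≡ 0 × AgreeFrom (toℕ i) a b) ⊎ (change i a b ≡ 1 × ¬ AgreeFrom (toℕ i) a b)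

  change-cases : ∀ i a b → ChangeCases i a b
  change-cases i a b with ≡-dec _≟_ (π i a) (π i b)
  ... | yes eq = inj₁ (refl , π≡⇒agree i eq)
  ... | no neq = inj₂ (refl , neq ∘ agree⇒π≡ i)

  change≤1 : ∀ i a b → change i a b ≤ 1
  change≤1 i a b with change-cases i a b
  ... | inj₁ (c≡0 , _) = subst (_≤ 1) (sym c≡0) z≤n
  ... | inj₂ (c≡1 , _) = ≤-reflexive c≡1

module _ {n : ℕ} (i : Fin n) where

  bar-first : ∀ L → barAt i L 0 ≡ 1
  bar-first []          = refl
  bar-first (_ ∷ [])    = refl
  bar-first (_ ∷ _ ∷ _) = refl

  bar-step≥ : ∀ L x → barAt i L x ≤ barAt i L (suc x)
  bar-step≥ []          _       = ≤-refl
  bar-step≥ (_ ∷ [])    _       = ≤-refl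
  bar-step≥ (a ∷ b ∷ L) zero    rewrite bar-first (b ∷ L) = m≤n+m 1 (change i a b)
  bar-step≥ (a ∷ b ∷ L) (suc x) = +-monoʳ-≤ (change i a b) (bar-step≥ (b ∷ L) x)

  bar-step≤ : ∀ L x → barAt i L (suc x) ≤ suc (barAt i L x)
  bar-step≤ []          _       = s≤s z≤n
  bar-step≤ (_ ∷ [])    _       = s≤s z≤n
  bar-step≤ (a ∷ b ∷ L) zero    rewrite bar-first (b ∷ L) =
    subst (_≤ 2) (+-comm 1 (change i a b)) (s≤s (change≤1 i a b))
  bar-step≤ (a ∷ b ∷ L) (suc x) =
    subst (change i a b + barAt i (b ∷ L) (suc x) ≤_) (+-suc (change i a b) (barAt i (b ∷ L) x))
          (+-monoʳ-≤ (change i a b) (bar-step≤ (b ∷ L) x))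

  bar-mono : ∀ L {x y} → x ≤ y → barAt i L x ≤ barAt i L y
  bar-mono L {y = zero} z≤n = ≤-refl
  bar-mono L {x} {suc y} x≤1+y with m≤n⇒m<n∨m≡n x≤1+y
  ... | inj₁ (s≤s x≤y) = ≤-trans (bar-mono L x≤y) (bar-step≥ L y)
  ... | inj₂ refl      = ≤-refl

  bar-next : ∀ L {x} y → x ≤ y → barAt i L x < barAt i L y →
    ∃[ f ] (x < f × f ≤ y × barAt i L f ≡ suc (barAt i L x))
  bar-next L zero z≤n lt = ⊥-elim (<-irrefl refl lt)
  bar-next L {x} (suc y) x≤1+y lt with m≤n⇒m<n∨m≡n x≤1+y
  ... | inj₂ refl = ⊥-elim (<-irrefl refl lt)
  ... | inj₁ (s≤s x≤y) with barAt i L x <? barAt i L y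
  ...   | yes lt′ with bar-next L y x≤y lt′
  ...     | f , x<f , f≤y , starts = f , x<f , m≤n⇒m≤1+n f≤y , starts
  bar-next L {x} (suc y) x≤1+y lt | inj₁ (s≤s x≤y) | no ≮ =
    suc y , s≤s x≤y , ≤-refl ,
    ≤-antisym (subst (λ z → barAt i L (suc y) ≤ suc z) (sym same) (bar-step≤ L y)) lt
    where
    same : barAt i L x ≡ barAt i L y
    same = ≤-antisym (bar-mono L x≤y) (≮⇒≥ ≮)

module _ {n : ℕ} where

  deg-· : ∀ (l : Fin n) (a b : Term n) → deg l (a · b) ≡ deg l a + deg l b
  deg-· l a b = lookup-zipWith _+_ l a b

  deg-/ : ∀ (l : Fin n) (a b : Term n) → deg l (a / b) ≡ deg l a ∸ deg l b
  deg-/ l a b = lookup-zipWith _∸_ l a b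

  deg-power-same : ∀ (i : Fin n) k → deg i (power i k) ≡ k
  deg-power-same i k = lookup∘update i (replicate n 0) k

  deg-power-other : ∀ (i l : Fin n) k → l ≢ i → deg l (power i k) ≡ 0
  deg-power-other i l k l≢i = trans (lookup∘update′ l≢i (replicate n 0) k) (lookup-replicate l 0)

  term-ext : ∀ {a b : Term n} → (∀ l → deg l a ≡ deg l b) → a ≡ b
  term-ext {a} {b} same = trans (sym (tabulate∘lookup a)) (trans (tabulate-cong same) (tabulate∘lookup b))

  cofactor : ∀ {s v w : Term n} → w ≡ s · v → w / s ≡ v
  cofactor {s} {v} refl = term-ext λ l → begin
    deg l ((s · v) / s)          ≡⟨ deg-/ l (s · v) s ⟩
    deg l (s · v) ∸ deg l s      ≡⟨ cong (_∸ deg l s) (deg-· l s v) ⟩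
    deg l s + deg l v ∸ deg l s  ≡⟨ m+n∸m≡n (deg l s) (deg l v) ⟩
    deg l v                      ∎
    where open ≡-Reasoning

  ∣⇒deg≤ : ∀ {a w : Term n} → a ∣ w → ∀ l → deg l a ≤ deg l w
  ∣⇒deg≤ {a} (v , refl) l = subst (deg l a ≤_) (sym (deg-· l a v)) (m≤m+n _ _)

  deg≤⇒∣ : ∀ {a w : Term n} → (∀ l → deg l a ≤ deg l w) → a ∣ w
  deg≤⇒∣ {a} {w} below = w / a , term-ext λ l →
    sym (trans (deg-· l a (w / a)) (trans (cong (deg l a +_) (deg-/ l w a)) (m+[n∸m]≡n (below l))))

  power-∣⇒ : ∀ (i : Fin n) k {v : Term n} → power i k ∣ v → k ≤ deg i v
  power-∣⇒ i k p∣v = subst (_≤ _) (deg-power-same i k) (∣⇒deg≤ p∣v i)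

  power-∣⇐ : ∀ (i : Fin n) k {v : Term n} → k ≤ deg i v → power i k ∣ v
  power-∣⇐ i k {v} k≤ = deg≤⇒∣ below
    where
    below : ∀ l → deg l (power i k) ≤ deg l v
    below l with l Fin.≟ i
    ... | yes refl = subst (_≤ deg l v) (sym (deg-power-same i k)) k≤
    ... | no l≢i   = subst (_≤ deg l v) (sym (deg-power-other i l k l≢i)) z≤n

-- u lies above s in direction j: same exponents beyond x_j and a larger
-- exponent of x_j.  Nonmultiplicative powers of s are measured against these u.
Above : ∀ {n} → Fin n → Term n → Term n → Set
Above j s u = SameTail j s u × deg j s < deg j u

module _ {n : ℕ} where

  above? : ∀ (j : Fin n) s → Decidable (Above j s)
  above? j s u =
    Fin.all? (λ l → (toℕ j <? toℕ l) →-dec (deg l u ≟ deg l s)) ×-dec (deg j s <? deg j u)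

  nmp⇒above : ∀ {U : List (Term n)} {s j k} → NMPow U s j k → Any (Above j s) U
  nmp⇒above ((u , u∈U , tail , 0<k , deg-u) , _) =
    lose u∈U (tail , subst (_ <_) (sym deg-u) (m<m+n _ 0<k))

  -- x_j is nonmultiplicative for s as soon as some u ∈ U lies above s in
  -- direction j: the power is realised by an Above term of least x_j-degree.
  nmp-exists : ∀ (U : List (Term n)) j s → Any (Above j s) U → ∃[ k ] NMPow U s j k
  nmp-exists U j s any-above with find any-above
  ... | u , u∈U , u-above =
    deg j m ∸ deg j s ,
    (m , m∈U , tail , m<n⇒0<n∸m s<m , sym (m+[n∸m]≡n (<⇒≤ s<m))) ,
    λ v v∈U v-tail s<v → subst (_≤ deg j v) (sym (m+[n∸m]≡n (<⇒≤ s<m))) (m-least v v∈U (v-tail , s<v))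
    where
    candidates : List (Term n)
    candidates = filter (above? j s) U
    m : Term n
    m = argmin (deg j) u candidates
    m-ok : m ∈ U × Above j s m
    m-ok = argmin-all (deg j) (u∈U , u-above) (All.tabulate (∈-filter⁻ (above? j s)))
    m∈U : m ∈ U
    m∈U = proj₁ m-ok
    tail : SameTail j s m
    tail = proj₁ (proj₂ m-ok)
    s<m : deg j s < deg j m
    s<m = proj₂ (proj₂ m-ok)
    m-least : ∀ v → v ∈ U → Above j s v → deg j m ≤ deg j v
    m-least v v∈U v-above =
      All.lookup (f[argmin]≤f[xs] {f = deg j} u candidates) (∈-filter⁺ (above? j s) v∈U v-above)

  nmp-unique : ∀ {U : List (Term n)} {s j k₁ k₂} → NMPow U s j k₁ → NMPow U s j k₂ → k₁ ≡ k₂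
  nmp-unique {s = s} {j} nmp₁ nmp₂ = ≤-antisym (least nmp₁ nmp₂) (least nmp₂ nmp₁)
    where
    least : ∀ {k k′} → NMPow _ s j k → NMPow _ s j k′ → k ≤ k′
    least (_ , minimal) ((u , u∈U , tail , 0<k′ , deg-u) , _) =
      +-cancelˡ-≤ (deg j s) _ _
        (subst (deg j s + _ ≤_) deg-u (minimal u u∈U tail (subst (_ <_) (sym deg-u) (m<m+n _ 0<k′))))

  cofactor-below-nmp : ∀ {U : List (Term n)} {s v j k} → ¬ NM U s v → NMPow U s j k → deg j v < k
  cofactor-below-nmp {j = j} {k} notNM nmp = ≰⇒> (λ k≤ → notNM (j , k , nmp , power-∣⇐ j k k≤))

last-column : ∀ {x m} → x < m → m ∸ 1 < m × x ≤ m ∸ 1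
last-column {m = suc m} (s≤s x≤m) = n<1+n m , x≤m

-- The term in column x of the list (an arbitrary term past the end).
module _ {n : ℕ} where

  at : List (Term n) → ℕ → Term n
  at []      _       = replicate n 0
  at (a ∷ _) zero    = a
  at (_ ∷ L) (suc x) = at L x

  lookup≡at : ∀ (L : List (Term n)) (x : Fin (length L)) → lookup L x ≡ at L (toℕ x)
  lookup≡at (_ ∷ _) Fin.zero    = refl
  lookup≡at (_ ∷ L) (Fin.suc x) = lookup≡at L x

  at∈ : ∀ (L : List (Term n)) {x} → x < length L → at L x ∈ L
  at∈ (_ ∷ _) {zero}  _         = here refl
  at∈ (_ ∷ L) {suc x} (s≤s x<)  = there (at∈ L x<)

  ∈⇒at : ∀ {L : List (Term n)} {v} → v ∈ L → ∃[ x ] (x < length L × at L x ≡ v)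
  ∈⇒at {L} v∈L = toℕ (index v∈L) , toℕ<n _ , sym (trans (lookup-index v∈L) (lookup≡at L _))

  sorted : ∀ {L : List (Term n)} → Linked _<Lex_ L → ∀ {x y} → x < y → y < length L → at L x <Lex at L y
  sorted (r ∷ _)  {zero}  {suc zero}    _ _ = r
  sorted {a ∷ b ∷ L} (r ∷ lk) {zero} {suc (suc y)} _ (s≤s y<) =
    <Lex-trans {a = a} {b = b} {c = at L y} r (sorted lk {zero} {suc y} (s≤s z≤n) y<)
  sorted (_ ∷ lk) {suc x} {suc y} (s≤s x<y) (s≤s y<) = sorted lk x<y y<
  sorted [-]      {zero}  {suc _} _ (s≤s ())
  sorted [-]      {suc _} {suc _} _ (s≤s ())

  sorted≤ : ∀ {L : List (Term n)} → Linked _<Lex_ L → ∀ {x y} → x ≤ y → y < length L → at L x ≤Lex at L y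
  sorted≤ lk x≤y y< with m≤n⇒m<n∨m≡n x≤y
  ... | inj₁ x<y  = inj₂ (sorted lk x<y y<)
  ... | inj₂ refl = inj₁ refl

  column-order : ∀ {L : List (Term n)} → Linked _<Lex_ L → ∀ {x y} →
    x < length L → y < length L → at L x <Lex at L y → x < y
  column-order {L} lk {x} {y} x< y< lt with x <? y
  ... | yes x<y = x<y
  ... | no x≮y with sorted≤ lk (≮⇒≥ x≮y) x<
  ...   | inj₁ eq = ⊥-elim (<Lex-irrefl {a = at L y} (subst (_<Lex at L y) (sym eq) lt))
  ...   | inj₂ gt = ⊥-elim (<Lex-irrefl {a = at L x} (<Lex-trans {a = at L x} {b = at L y} {c = at L x} lt gt))

module _ {n : ℕ} (i : Fin n) where

  private
    bar≥1 : ∀ L x → 1 ≤ barAt i L x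
    bar≥1 L x = subst (_≤ barAt i L x) (bar-first i L) (bar-mono i L z≤n)

  sameBar⇒agree≤ : ∀ {L : List (Term n)} → Linked _<Lex_ L → ∀ {x y} → x ≤ y → y < length L →
    barAt i L x ≡ barAt i L y → AgreeFrom (toℕ i) (at L x) (at L y)
  sameBar⇒agree≤ _ {zero} {zero} _ _ _ = agree-refl
  sameBar⇒agree≤ [-] {y = suc _} _ (s≤s ())
  sameBar⇒agree≤ {a ∷ b ∷ L} (_ ∷ lk) {zero} {suc y} _ (s≤s y<) = joined (change-cases i a b)
    where
    joined : ChangeCases i a b → 1 ≡ change i a b + barAt i (b ∷ L) y → AgreeFrom (toℕ i) a (at (b ∷ L) y)
    joined (inj₁ (c≡0 , a~b)) eq =
      agree-trans a~b (sameBar⇒agree≤ lk z≤n y< (trans (bar-first i (b ∷ L)) (trans eq (cong (_+ _) c≡0))))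
    joined (inj₂ (c≡1 , _)) eq =
      ⊥-elim (<-irrefl eq (subst (λ c → 1 < c + barAt i (b ∷ L) y) (sym c≡1) (s≤s (bar≥1 (b ∷ L) y))))
  sameBar⇒agree≤ {a ∷ b ∷ L} (_ ∷ lk) {suc x} {suc y} (s≤s x≤y) (s≤s y<) eq =
    sameBar⇒agree≤ lk x≤y y< (+-cancelˡ-≡ (change i a b) _ _ eq)

  agree⇒sameBar≤ : ∀ {L : List (Term n)} → Linked _<Lex_ L → ∀ {x y} → x ≤ y → y < length L →
    AgreeFrom (toℕ i) (at L x) (at L y) → barAt i L x ≡ barAt i L y
  agree⇒sameBar≤ _ {zero} {zero} _ _ _ = refl
  agree⇒sameBar≤ [-] {y = suc _} _ (s≤s ())
  agree⇒sameBar≤ {a ∷ b ∷ L} (r ∷ lk) {zero} {suc y} _ (s≤s y<) a~y = begin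
    1                                   ≡⟨ sym (bar-first i (b ∷ L)) ⟩
    barAt i (b ∷ L) 0                   ≡⟨ agree⇒sameBar≤ lk z≤n y< b~y ⟩
    barAt i (b ∷ L) y                   ≡⟨ cong (_+ barAt i (b ∷ L) y) (sym no-change) ⟩
    change i a b + barAt i (b ∷ L) y    ∎
    where
    open ≡-Reasoning
    a~b : AgreeFrom (toℕ i) a b
    a~b = agree-between (inj₂ r) (sorted≤ lk {zero} {y} z≤n y<) a~y
    b~y : AgreeFrom (toℕ i) b (at (b ∷ L) y)
    b~y = agree-trans (agree-sym a~b) a~y
    no-change : change i a b ≡ 0
    no-change with change-cases i a b
    ... | inj₁ (c≡0 , _)     = c≡0
    ... | inj₂ (_ , differ)  = ⊥-elim (differ a~b)
  agree⇒sameBar≤ {a ∷ b ∷ L} (_ ∷ lk) {suc x} {suc y} (s≤s x≤y) (s≤s y<) ag =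
    cong (change i a b +_) (agree⇒sameBar≤ lk x≤y y< ag)

  sameBar⇒agree : ∀ {L : List (Term n)} → Linked _<Lex_ L → ∀ {x y} → x < length L → y < length L →
    barAt i L x ≡ barAt i L y → AgreeFrom (toℕ i) (at L x) (at L y)
  sameBar⇒agree lk {x} {y} x< y< eq with ≤-total x y
  ... | inj₁ x≤y = sameBar⇒agree≤ lk x≤y y< eq
  ... | inj₂ y≤x = agree-sym (sameBar⇒agree≤ lk y≤x x< (sym eq))

  agree⇒sameBar : ∀ {L : List (Term n)} → Linked _<Lex_ L → ∀ {x y} → x < length L → y < length L →
    AgreeFrom (toℕ i) (at L x) (at L y) → barAt i L x ≡ barAt i L y
  agree⇒sameBar lk {x} {y} x< y< ag with ≤-total x y
  ... | inj₁ x≤y = agree⇒sameBar≤ lk x≤y y< ag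
  ... | inj₂ y≤x = sym (agree⇒sameBar≤ lk y≤x x< (agree-sym ag))

  above⇒laterBar : ∀ {L : List (Term n)} → Linked _<Lex_ L → ∀ {d e} → d < length L → e < length L →
    Above i (at L d) (at L e) → d < e × barAt i L d < barAt i L e
  above⇒laterBar {L} lk {d} {e} d< e< (tail , s<u) =
    d<e , ≤∧≢⇒< (bar-mono i L (<⇒≤ d<e))
                (λ eq → <⇒≢ s<u (agreeAt (sameBar⇒agree lk d< e< eq) i ≤-refl))
    where
    d<e : d < e
    d<e = column-order lk d< e< (i , s<u , λ l i<l → sym (tail l i<l))

  laterBar⇒above : ∀ {L : List (Term n)} → Linked _<Lex_ L → ∀ {d e} → d < length L → e < length L →
    barAt i L d < barAt i L e → AgreeFrom (suc (toℕ i)) (at L d) (at L e) → Above i (at L d) (at L e)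
  laterBar⇒above {L} lk {d} {e} d< e< later above-i =
    agree⇒tail above-i , <Lex⇒deg< (sorted lk d<e e<) above-i differ
    where
    d<e : d < e
    d<e = ≰⇒> (λ e≤d → <⇒≱ later (bar-mono i L e≤d))
    differ : ¬ AgreeFrom (toℕ i) (at L d) (at L e)
    differ ag = <⇒≢ later (agree⇒sameBar lk d< e< ag)

liesOverAt : ∀ {n} {i i′ : Fin n} {U : List (Term n)} {e} → (e< : e < length U) →
  LiesOver i i′ U (barAt i U e) (barAt i′ U e)
liesOverAt {i = i} {i′} {U} e< =
  fromℕ< e< , cong (barAt i U) (toℕ-fromℕ< e<) , cong (barAt i′ U) (toℕ-fromℕ< e<)

module _ {n : ℕ} {U : List (Term n)} (lk : Linked _<Lex_ U) (j : Fin n) {d} (d< : d < length U) where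

  private
    s : Term n
    s = at U d
    b : ℕ
    b = barAt j U d

  noAbove⇒star : ¬ Any (Above j s) U → StarAfter j U b
  noAbove⇒star none with b ≟ μ j U
  ... | yes last = inj₁ last
  ... | no notLast with suc (toℕ j) <? n
  -- x_j is the last variable: the last column, on a later bar, lies above s
  ...   | no j-top = ⊥-elim (none (lose (at∈ U f<) (laterBar⇒above j lk d< f< later (agree-beyond (≮⇒≥ j-top)))))
    where
    f< : length U ∸ 1 < length U
    f< = proj₁ (last-column d<)
    later : b < μ j U
    later = ≤∧≢⇒< (bar-mono j U (proj₂ (last-column d<))) notLast
  ...   | yes j+1<n =
    inj₂ (≤∧≢⇒< (bar-mono j U (proj₂ (last-column d<))) notLast ,
          fromℕ< j+1<n , toℕ-fromℕ< j+1<n , separated)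
    where
    j′ : Fin n
    j′ = fromℕ< j+1<n
    -- columns e₁ on bar b and e₂ on bar b+1 over a common (j+1)-bar would put at e₂ above s
    separated : ¬ (∃[ b′ ] (LiesOver j j′ U b b′ × LiesOver j j′ U (suc b) b′))
    separated (_ , (e₁ , bar-e₁ , top-e₁) , (e₂ , bar-e₂ , top-e₂)) =
      none (lose (at∈ U e₂<) (laterBar⇒above j lk d< e₂< (≤-reflexive (sym bar-e₂)) s~e₂))
      where
      e₁< : toℕ e₁ < length U
      e₁< = toℕ<n e₁
      e₂< : toℕ e₂ < length U
      e₂< = toℕ<n e₂
      e₁~s : AgreeFrom (toℕ j) (at U (toℕ e₁)) s
      e₁~s = sameBar⇒agree j lk e₁< d< bar-e₁
      e₁~e₂ : AgreeFrom (toℕ j′) (at U (toℕ e₁)) (at U (toℕ e₂))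
      e₁~e₂ = sameBar⇒agree j′ lk e₁< e₂< (trans top-e₁ (sym top-e₂))
      s~e₂ : AgreeFrom (suc (toℕ j)) s (at U (toℕ e₂))
      s~e₂ = agree-trans (agree-weaken (n≤1+n _) (agree-sym e₁~s))
                         (subst (λ m → AgreeFrom m _ _) (toℕ-fromℕ< j+1<n) e₁~e₂)

  star⇒noAbove : StarAfter j U b → ¬ Any (Above j s) U
  star⇒noAbove star any-above with find any-above
  ... | _ , u∈U , u-above with ∈⇒at u∈U
  ...   | e , e< , refl = excluded star
    where
    later : d < e × b < barAt j U e
    later = above⇒laterBar j lk d< e< u-above
    d<e : d < e
    d<e = proj₁ later
    -- the bar under u is at most the last one, so b is not the last bar
    excluded : StarAfter j U b → ⊥
    excluded (inj₁ last) =
      <⇒≱ (proj₂ later) (subst (barAt j U e ≤_) (sym last) (bar-mono j U (proj₂ (last-column e<))))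
    -- the first column f of bar b+1 agrees with s above j, so bars b and b+1
    -- lie over the (j+1)-bar under s
    excluded (inj₂ (_ , j′ , j′≡ , separated)) with bar-next j U e (<⇒≤ d<e) (proj₂ later)
    ... | f , d<f , f≤e , bar-f =
      separated (barAt j′ U d , liesOverAt {i = j} {j′} {U} d< ,
                 subst₂ (LiesOver j j′ U) bar-f same-top (liesOverAt {i = j} {j′} {U} f<))
      where
      f< : f < length U
      f< = ≤-<-trans f≤e e<
      s~f : AgreeFrom (suc (toℕ j)) s (at U f)
      s~f = agree-between (sorted≤ lk (<⇒≤ d<f) f<) (sorted≤ lk f≤e e<) (tail⇒agree (proj₁ u-above))
      same-top : barAt j′ U f ≡ barAt j′ U d
      same-top = agree⇒sameBar j′ lk f< d< (agree-sym (subst (λ m → AgreeFrom m _ _) (sym j′≡) s~f))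

-- The term realising the nonmultiplicative power x_i^k of t lies over the
-- i-bar right after the i-bar under t: the first column f of that next bar
-- already lies above t, so by minimality of k it agrees with the realiser.
realiser-on-next-bar : ∀ {n} {U : List (Term n)} → Linked _<Lex_ U → ∀ (i : Fin n) {k c e} →
  c < length U → e < length U → NMPow U (at U c) i k →
  SameTail i (at U c) (at U e) → deg i (at U e) ≡ deg i (at U c) + k →
  barAt i U e ≡ suc (barAt i U c)
realiser-on-next-bar {U = U} lk i {k} {c} {e} c< e< ((_ , _ , _ , 0<k , _) , minimal) tail realises
  with above⇒laterBar i lk c< e< (tail , subst (_ <_) (sym realises) (m<m+n _ 0<k))
... | c<e , later with bar-next i U e (<⇒≤ c<e) later
... | f , c<f , f≤e , bar-f = trans (sym (agree⇒sameBar i lk f< e< f~e)) bar-f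
  where
  t : Term _
  t = at U c
  f< : f < length U
  f< = ≤-<-trans f≤e e<
  t~f : AgreeFrom (suc (toℕ i)) t (at U f)
  t~f = agree-between (sorted≤ lk (<⇒≤ c<f) f<) (sorted≤ lk f≤e e<) (tail⇒agree tail)
  f-above : Above i t (at U f)
  f-above = laterBar⇒above i lk c< f< (≤-reflexive (sym bar-f)) t~f
  f~e-above : AgreeFrom (suc (toℕ i)) (at U f) (at U e)
  f~e-above = agree-trans (agree-sym t~f) (tail⇒agree tail)
  f~e : AgreeFrom (toℕ i) (at U f) (at U e)
  f~e = agree-extendAt
    (≤-antisym (≤Lex⇒deg≤ (sorted≤ lk f≤e e<) f~e-above)
               (subst (_≤ deg i (at U f)) (sym realises)
                      (minimal (at U f) (at∈ U f<) (proj₁ f-above) (proj₂ f-above))))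
    f~e-above

-- Descending over the
-- variables: where s and w agree above l, an exponent deg_l s < deg_l w
-- would put u above s in direction l, and the resulting nonmultiplicative
-- power of s would divide v.
janet-divisor-agrees : ∀ {n} {U : List (Term n)} {s v w u : Term n} {m} →
  w ≡ s · v → ¬ NM U s v → u ∈ U → AgreeFrom m u w → AgreeFrom m s w
janet-divisor-agrees {U = U} {s} {v} {w} {u} {m} w≡sv notNM u∈U u~w = agree-by-descent step
  where
  step : ∀ l → m ≤ toℕ l → AgreeFrom (suc (toℕ l)) s w → deg l s ≡ deg l w
  step l m≤l s~w with deg l s <? deg l w
  ... | no s≮w = ≤-antisym (∣⇒deg≤ (v , w≡sv) l) (≮⇒≥ s≮w)
  ... | yes s<w = ⊥-elim (<⇒≱ (cofactor-below-nmp {U = U} {s} {v} notNM nmp) k′≤v)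
    where
    u-above : Above l s u
    u-above = agree⇒tail (agree-trans s~w (agree-sym (agree-weaken (m≤n⇒m≤1+n m≤l) u~w))) ,
              subst (deg l s <_) (sym (agreeAt u~w l m≤l)) s<w
    k′ : ℕ
    k′ = proj₁ (nmp-exists U l s (lose u∈U u-above))
    nmp : NMPow U s l k′
    nmp = proj₂ (nmp-exists U l s (lose u∈U u-above))
    open ≤-Reasoning
    k′≤v : k′ ≤ deg l v
    k′≤v = +-cancelˡ-≤ (deg l s) k′ (deg l v) (begin
      deg l s + k′       ≤⟨ proj₂ nmp u u∈U (proj₁ u-above) (proj₂ u-above) ⟩
      deg l u            ≡⟨ agreeAt u~w l m≤l ⟩
      deg l w            ≡⟨ cong (deg l) w≡sv ⟩
      deg l (s · v)      ≡⟨ deg-· l s v ⟩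
      deg l s + deg l v  ∎)

module Criterion {n} {U : List (Term n)} (lk : Linked _<Lex_ U) (i : Fin n) (k : ℕ) {c d}
                 (c< : c < length U) (d< : d < length U) where

  private
    t s w : Term n
    t = at U c
    s = at U d
    w = power i k · t

  StarOrLargePower : Set
  StarOrLargePower = ∀ j′ → 1 ≤ deg j′ (w / s) →
    StarAfter j′ U (barAt j′ U d) ⊎ ∃[ k′ ] (NMPow U s j′ k′ × deg j′ (w / s) < k′)

  -- p·t differs from t only by raising the exponent of x_i by k, so the term
  -- realising x_i^k agrees with p·t from position i.
  realiser-agrees : ∀ {u} → SameTail i t u → deg i u ≡ deg i t + k → AgreeFrom (toℕ i) u w
  realiser-agrees {u} tail realises = agree-extendAt at-i (agree above-i)
    where
    open ≡-Reasoning
    at-i : deg i u ≡ deg i w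
    at-i = begin
      deg i u                       ≡⟨ realises ⟩
      deg i t + k                   ≡⟨ +-comm _ k ⟩
      k + deg i t                   ≡⟨ cong (_+ deg i t) (sym (deg-power-same i k)) ⟩
      deg i (power i k) + deg i t   ≡⟨ sym (deg-· i (power i k) t) ⟩
      deg i w                       ∎
    above-i : ∀ l → suc (toℕ i) ≤ toℕ l → deg l u ≡ deg l w
    above-i l i<l = begin
      deg l u                       ≡⟨ tail l i<l ⟩
      deg l t                       ≡⟨ cong (_+ deg l t) (sym (deg-power-other i l k (<⇒≢Fin i<l))) ⟩
      deg l (power i k) + deg l t   ≡⟨ sym (deg-· l (power i k) t) ⟩
      deg l w                       ∎

  divisor⇒conditions : NMPow U t i k → JLDivides U s w →
    (s ∣ w) × barAt i U d ≡ suc (barAt i U c) × StarOrLargePower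
  divisor⇒conditions nmp@((u , u∈U , tail , _ , realises) , _) (v , w≡sv , notNM) with ∈⇒at u∈U
  ... | e , e< , refl = (v , w≡sv) , bar-condition , star-condition
    where
    -- s agrees from i with p·t, hence with the realiser of x_i^k
    bar-condition : barAt i U d ≡ suc (barAt i U c)
    bar-condition = begin
      barAt i U d        ≡⟨ agree⇒sameBar i lk d< e< s~u ⟩
      barAt i U e        ≡⟨ realiser-on-next-bar lk i c< e< nmp tail realises ⟩
      suc (barAt i U c)  ∎
      where
      open ≡-Reasoning
      u~w : AgreeFrom (toℕ i) (at U e) w
      u~w = realiser-agrees tail realises
      s~u : AgreeFrom (toℕ i) s (at U e)
      s~u = agree-trans (janet-divisor-agrees w≡sv notNM u∈U u~w) (agree-sym u~w)
    star-condition : StarOrLargePower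
    star-condition j′ _ with any? (above? j′ s) U
    ... | no none = inj₁ (noAbove⇒star lk j′ d< none)
    ... | yes some with nmp-exists U j′ s some
    ...   | k′ , nmp′ =
      inj₂ (k′ , nmp′ , subst (λ q → deg j′ q < k′) (sym (cofactor w≡sv))
                              (cofactor-below-nmp {U = U} {s} notNM nmp′))

  -- (1) and (3) already exclude every nonmultiplicative power of s from
  -- dividing the cofactor w/s.
  conditions⇒divisor : (s ∣ w) × barAt i U d ≡ suc (barAt i U c) × StarOrLargePower → JLDivides U s w
  conditions⇒divisor ((v , w≡sv) , _ , star-or-large) = v , w≡sv , notNM
    where
    notNM : ¬ NM U s v
    notNM (j′ , k′ , nmp′@((_ , _ , _ , 0<k′ , _) , _) , p∣v) =
      excluded (star-or-large j′ (≤-trans 0<k′ k′≤q))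
      where
      k′≤q : k′ ≤ deg j′ (w / s)
      k′≤q = subst (λ q → k′ ≤ deg j′ q) (sym (cofactor w≡sv)) (power-∣⇒ j′ k′ p∣v)
      excluded : StarAfter j′ U (barAt j′ U d) ⊎ ∃[ k″ ] (NMPow U s j′ k″ × deg j′ (w / s) < k″) → ⊥
      excluded (inj₁ star)               = star⇒noAbove lk j′ d< star (nmp⇒above {s = s} nmp′)
      excluded (inj₂ (_ , nmp″ , q<k″)) = <⇒≱ q<k″ (subst (_≤ _) (nmp-unique {s = s} nmp′ nmp″) k′≤q)

theorem24 : ∀ {n} (U : List (Term n)) → Linked _<Lex_ U →
    (c : Fin (length U)) (i : Fin n) (k : ℕ) →
    NMPow U (lookup U c) i k →
    (d : Fin (length U)) →
    JLDivides U (lookup U d) (power i k · lookup U c)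
    ⇔ ((lookup U d ∣ (power i k · lookup U c))
       × barUnder i U d ≡ suc (barUnder i U c)
       × (∀ j′ → 1 ≤ deg j′ ((power i k · lookup U c) / lookup U d) →
            StarAfter j′ U (barUnder j′ U d)
            ⊎ ∃[ k′ ] (NMPow U (lookup U d) j′ k′
                       × deg j′ ((power i k · lookup U c) / lookup U d) < k′)))
theorem24 U lk c i k nmp d rewrite lookup≡at U c | lookup≡at U d =
  mk⇔ (divisor⇒conditions nmp) conditions⇒divisor
  where open Criterion lk i k (toℕ<n c) (toℕ<n d)
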